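{- Let $G$ be a bipartite graph with bipartition $(X,Y)$ such that $d_G(y)\ge 3$ for all $y\in Y$. If $|X|\ge 3$ and $|Y|\ge 2|X|-3$, then $Y$ has a subset $Z$ such that the induced subgraph $G[N[Z]]$ is $3$-connected.
   Context: All graphs are finite and simple. For a vertex set $Z$, $N[Z]=\bigcup_{z\in Z}N[z]$ is its closed neighborhood, where $N[z]$ is $z$ together with its neighbors. A graph is $3$-connected if it has more than $3$ vertices and no vertex cut of size less than $3$. -}

module Defs where

open import Data.Nat using (ℕ; _≤_)
open import Data.Bool using (Bool; true; false)
open import Data.Fin using (Fin)
open import Data.Fin.Subset using (Subset; _∈_; ∣_∣)
open import Data.Vec using (tabulate)
open import Data.Sum using (_⊎_; inj₁; inj₂)
open import Data.Product using (Σ; ∃; _×_)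
open import Data.Empty using (⊥)
open import Data.List using (List; length)
import Data.List.Membership.Propositional as LM
open import Relation.Binary.PropositionalEquality using (_≡_; _≢_)
open import Relation.Nullary using (¬_)

-- A finite simple bipartite graph with bipartition (X , Y), X = Fin p, Y = Fin q,
-- given by its bi-adjacency relation E x y = true iff x ~ y.
BipGraph : ℕ → ℕ → Set
BipGraph p q = Fin p → Fin q → Bool

V : ℕ → ℕ → Set
V p q = Fin p ⊎ Fin q

Adj : ∀ {p q} → BipGraph p q → V p q → V p q → Set
Adj E (inj₁ x) (inj₂ y) = E x y ≡ true
Adj E (inj₂ y) (inj₁ x) = E x y ≡ true
Adj E (inj₁ _) (inj₁ _) = ⊥
Adj E (inj₂ _) (inj₂ _) = ⊥

degY : ∀ {p q} → BipGraph p q → Fin q → ℕ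
degY E y = ∣ tabulate (λ x → E x y) ∣

VSet : ℕ → ℕ → Set₁
VSet p q = V p q → Set

NZ : ∀ {p q} → BipGraph p q → Subset q → VSet p q
NZ E Z (inj₁ x) = Σ (Fin _) (λ z → (z ∈ Z) × (E x z ≡ true))
NZ E Z (inj₂ y) = y ∈ Z

_∖_ : ∀ {p q} → VSet p q → List (V p q) → VSet p q
(W ∖ S) v = W v × ¬ (v LM.∈ S)

data Reach {p q} (E : BipGraph p q) (W : VSet p q) : V p q → V p q → Set where
  here : ∀ {v} → W v → Reach E W v v
  step : ∀ {u v w} → W u → Adj E u v → Reach E W v w → Reach E W u w

Connected : ∀ {p q} → BipGraph p q → VSet p q → Set
Connected E W = ∀ u v → W u → W v → Reach E W u v

MoreThan3 : ∀ {p q} → VSet p q → Set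
MoreThan3 W = ∃ λ a → ∃ λ b → ∃ λ c → ∃ λ d →
  W a × W b × W c × W d ×
  a ≢ b × a ≢ c × a ≢ d × b ≢ c × b ≢ d × c ≢ d

ThreeConnected : ∀ {p q} → BipGraph p q → VSet p q → Set
ThreeConnected E W =
  MoreThan3 W × (∀ (S : List (V _ _)) → length S ≤ 2 → Connected E (W ∖ S))

-- Call a nonempty Z ⊆ Y admissible if 2|N(Z)| ≤ |Z| + 3; by hypothesis Y is admissible.
-- Descend along admissible sets, decreasing |N(Z)| + |Z|, until G[N[Z]] is 3-connected; it
-- has more than 3 vertices because every y ∈ Z has three neighbours. If S, |S| ≤ 2,
-- separates u from v in G[N[Z]], colour G[N[Z]] − S by reachability from u and split
-- Z − S into the colour classes Z₁, Z₂. Then N(Zᵢ) ⊆ Xᵢ, the vertices of N(Z) that are in S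
-- or have colour i, so |X₁| + |X₂| ≤ |N(Z)| + |S ∩ X| and |Z| ≤ |Z₁| + |Z₂| + |S ∩ Y|. As
-- |S| ≤ 2, one nonempty Zᵢ inherits the bound 2|Xᵢ| ≤ |Zᵢ| + 3, and it misses u or v,
-- so its weight is smaller. If Z₁ is empty then u lies in X, so |X₂| < |N(Z)| and Z₂ works.
-- The descent is constructive because reachability in a finite graph is decidable: a path
-- from u to v ≠ u leaves u along an edge and can then avoid u.
module Submission where

open import Defs
open import Data.Bool using (Bool; true; false; not)
import Data.Bool.Properties as Bool
open import Data.Bool.Properties using (not-¬; ¬-not)
open import Data.Empty using (⊥-elim)
open import Data.Fin using (Fin; zero; suc)
open import Data.Fin.Properties using (_≟_; any?; suc-injective)
open import Data.Fin.Subset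
  using (Subset; inside; outside; _∈_; _⊆_; _∪_; _∩_; ⁅_⁆; ⊥; ⊤; ∣_∣; Nonempty; Empty)
open import Data.Fin.Subset.Properties
  using (_∈?_; p⊆q⇒∣p∣≤∣q∣; p⊂q⇒∣p∣<∣q∣; x∈p∪q⁺; x∈p∪q⁻; x∈p∩q⁻; x∈⁅x⁆; ∣⁅x⁆∣≡1;
         ∣⊥∣≡0; ∣⊤∣≡n; ∣p∣≤n; Empty-unique; nonempty?)
open import Data.List using (List; []; _∷_; length; [_])
open import Data.List.Membership.Propositional using () renaming (_∈_ to _∈ˡ_)
import Data.List.Membership.DecPropositional as DecMembership
open import Data.List.Relation.Unary.Any using (here; there)
open import Data.Nat using (ℕ; suc; _≤_; _<_; _+_; _*_; z≤n; s≤s; _≤?_)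
open import Data.Nat.Induction using (<-wellFounded)
open import Data.Nat.Properties
  using (≤-trans; ≤-reflexive; m≤m+n; +-suc; +-assoc; +-mono-≤; +-monoˡ-≤; +-monoʳ-≤;
         +-mono-<-≤; +-mono-≤-<; *-monoʳ-≤; +-cancelʳ-≤; m+n≤o⇒m≤o; m+n≤o⇒n≤o; ≰⇒>; n≮n;
         module ≤-Reasoning)
open import Data.Nat.Tactic.RingSolver using (solve)
open import Data.Product using (Σ; ∃; _×_; _,_; proj₁; proj₂)
open import Data.Sum using (_⊎_; inj₁; inj₂; [_,_]′; swap)
open import Data.Sum.Properties using (≡-dec; inj₁-injective)
open import Data.Vec using (tabulate)
import Data.Vec as Vec
open import Data.Vec.Properties using (lookup∘tabulate; lookup⇒[]=; []=⇒lookup)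
open import Function using (_∘_)
open import Function.Definitions using (Injective)
open import Induction.WellFounded using (Acc; acc)
open import Level using (Level)
open import Relation.Binary.Definitions using (DecidableEquality)
open import Relation.Binary.PropositionalEquality
  using (_≡_; _≢_; refl; sym; trans; cong; cong₂; subst; module ≡-Reasoning)
open import Relation.Nullary using (Dec; yes; no; does; ¬_)
open import Relation.Nullary.Decidable
  using (dec-true; dec-false; map′; toSum; ¬?; _×-dec_; _⊎-dec_)
open import Relation.Unary using (Pred; Decidable)

private
  variable
    ℓ ℓ′ : Level
    n : ℕ

module _ where
  -- Opened only here: elsewhere [] and _∷_ must mean List's for the variable lists of solve.
  open Vec using ([]; _∷_)

  ∣p∪q∣+∣p∩q∣≡∣p∣+∣q∣ : (p q : Subset n) → ∣ p ∪ q ∣ + ∣ p ∩ q ∣ ≡ ∣ p ∣ + ∣ q ∣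
  ∣p∪q∣+∣p∩q∣≡∣p∣+∣q∣ [] [] = refl
  ∣p∪q∣+∣p∩q∣≡∣p∣+∣q∣ (outside ∷ p) (outside ∷ q) = ∣p∪q∣+∣p∩q∣≡∣p∣+∣q∣ p q
  ∣p∪q∣+∣p∩q∣≡∣p∣+∣q∣ (inside ∷ p) (outside ∷ q) = cong suc (∣p∪q∣+∣p∩q∣≡∣p∣+∣q∣ p q)
  ∣p∪q∣+∣p∩q∣≡∣p∣+∣q∣ (outside ∷ p) (inside ∷ q) =
    trans (cong suc (∣p∪q∣+∣p∩q∣≡∣p∣+∣q∣ p q)) (sym (+-suc ∣ p ∣ ∣ q ∣))
  ∣p∪q∣+∣p∩q∣≡∣p∣+∣q∣ (inside ∷ p) (inside ∷ q) = cong suc (begin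
    ∣ p ∪ q ∣ + suc ∣ p ∩ q ∣    ≡⟨ +-suc ∣ p ∪ q ∣ ∣ p ∩ q ∣ ⟩
    suc (∣ p ∪ q ∣ + ∣ p ∩ q ∣)  ≡⟨ cong suc (∣p∪q∣+∣p∩q∣≡∣p∣+∣q∣ p q) ⟩
    suc (∣ p ∣ + ∣ q ∣)          ≡⟨ sym (+-suc ∣ p ∣ ∣ q ∣) ⟩
    ∣ p ∣ + suc ∣ q ∣            ∎)
    where open ≡-Reasoning

  distinct-members : ∀ {k} (p : Subset n) → k ≤ ∣ p ∣ →
    ∃ λ (f : Fin k → Fin n) → Injective _≡_ _≡_ f × (∀ i → f i ∈ p)
  distinct-members [] z≤n = (λ ()) , (λ {}) , λ ()
  distinct-members (outside ∷ p) k≤∣p∣ =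
    let f , f-injective , f∈p = distinct-members p k≤∣p∣
    in suc ∘ f , f-injective ∘ suc-injective , Vec.there ∘ f∈p
  distinct-members {k = 0} (inside ∷ p) _ = (λ ()) , (λ {}) , λ ()
  distinct-members {k = suc k} (inside ∷ p) (s≤s k≤∣p∣) =
    let f , f-injective , f∈p = distinct-members p k≤∣p∣
    in extend f , extend-injective f-injective , λ { zero → Vec.here ; (suc i) → Vec.there (f∈p i) }
    where
    extend : (Fin k → Fin _) → Fin (suc k) → Fin (suc _)
    extend f zero = zero
    extend f (suc i) = suc (f i)
    extend-injective : ∀ {f} → Injective _≡_ _≡_ f → Injective _≡_ _≡_ (extend f)
    extend-injective f-injective {zero} {zero} _ = refl
    extend-injective f-injective {suc i} {suc j} e = cong suc (f-injective (suc-injective e))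

∣p∪q∣≤∣p∣+∣q∣ : (p q : Subset n) → ∣ p ∪ q ∣ ≤ ∣ p ∣ + ∣ q ∣
∣p∪q∣≤∣p∣+∣q∣ p q = ≤-trans (m≤m+n ∣ p ∪ q ∣ ∣ p ∩ q ∣) (≤-reflexive (∣p∪q∣+∣p∩q∣≡∣p∣+∣q∣ p q))

Empty⇒∣p∣≡0 : {p : Subset n} → Empty p → ∣ p ∣ ≡ 0
Empty⇒∣p∣≡0 {n} empty = trans (cong ∣_∣ (Empty-unique empty)) (∣⊥∣≡0 n)

1≤∣p∣⇒Nonempty : {p : Subset n} → 1 ≤ ∣ p ∣ → Nonempty p
1≤∣p∣⇒Nonempty {p = p} 1≤∣p∣ = let f , _ , f∈p = distinct-members p 1≤∣p∣ in f zero , f∈p zero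

∈-tabulate⁺ : {f : Fin n → Bool} {x : Fin n} → f x ≡ true → x ∈ tabulate f
∈-tabulate⁺ {f = f} {x} fx≡true = lookup⇒[]= x (tabulate f) (trans (lookup∘tabulate f x) fx≡true)

∈-tabulate⁻ : {f : Fin n → Bool} {x : Fin n} → x ∈ tabulate f → f x ≡ true
∈-tabulate⁻ {f = f} {x} x∈ = trans (sym (lookup∘tabulate f x)) ([]=⇒lookup x∈)

subset : {P : Pred (Fin n) ℓ} → Decidable P → Subset n
subset P? = tabulate (does ∘ P?)

module _ {P : Pred (Fin n) ℓ} (P? : Decidable P) where

  ∈-subset⁺ : ∀ {x} → P x → x ∈ subset P?
  ∈-subset⁺ {x} px = ∈-tabulate⁺ (dec-true (P? x) px)

  ∈-subset⁻ : ∀ {x} → x ∈ subset P? → P x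
  ∈-subset⁻ {x} x∈ with P? x | ∈-tabulate⁻ {f = does ∘ P?} x∈
  ... | yes px | _ = px

module _ {P Q : Pred (Fin n) ℓ} (P? : Decidable P) (Q? : Decidable Q)
         (P⊆Q : ∀ {x} → P x → Q x) where

  subset-⊆ : subset P? ⊆ subset Q?
  subset-⊆ x∈ = ∈-subset⁺ Q? (P⊆Q (∈-subset⁻ P? x∈))

  ∣subset∣-mono-≤ : ∣ subset P? ∣ ≤ ∣ subset Q? ∣
  ∣subset∣-mono-≤ = p⊆q⇒∣p∣≤∣q∣ subset-⊆

  ∣subset∣-mono-< : ∀ {x} → Q x → ¬ P x → ∣ subset P? ∣ < ∣ subset Q? ∣
  ∣subset∣-mono-< {x} qx ¬px = p⊂q⇒∣p∣<∣q∣ (subset-⊆ , x , ∈-subset⁺ Q? qx , ¬px ∘ ∈-subset⁻ P?)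

bound-inherited : ∀ {a a₁ a₂ b b₁ b₂ s t} →
  a₁ + a₂ ≤ a + s → b ≤ b₁ + b₂ + t → s + t ≤ 2 → 2 * a ≤ b + 3 →
  2 * a₁ ≤ b₁ + 3 ⊎ 2 * a₂ ≤ b₂ + 3
bound-inherited {a} {a₁} {a₂} {b} {b₁} {b₂} {s} {t} a₁+a₂≤a+s b≤ s+t≤2 2a≤b+3
  with 2 * a₁ ≤? b₁ + 3 | 2 * a₂ ≤? b₂ + 3
... | yes sparse₁ | _ = inj₁ sparse₁
... | no _ | yes sparse₂ = inj₂ sparse₂
... | no dense₁ | no dense₂ = ⊥-elim (n≮n (b + 7) (begin
  suc (b + 7)                          ≡⟨ solve (b ∷ []) ⟩
  b + 8                                ≤⟨ +-monoˡ-≤ 8 b≤ ⟩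
  b₁ + b₂ + t + 8                      ≡⟨ solve (b₁ ∷ b₂ ∷ t ∷ []) ⟩
  suc (b₁ + 3) + suc (b₂ + 3) + t      ≤⟨ +-monoˡ-≤ t (+-mono-≤ (≰⇒> dense₁) (≰⇒> dense₂)) ⟩
  2 * a₁ + 2 * a₂ + t                  ≡⟨ solve (a₁ ∷ a₂ ∷ t ∷ []) ⟩
  2 * (a₁ + a₂) + t                    ≤⟨ +-monoˡ-≤ t (*-monoʳ-≤ 2 a₁+a₂≤a+s) ⟩
  2 * (a + s) + t                      ≡⟨ solve (a ∷ s ∷ t ∷ []) ⟩
  2 * a + (s + (s + t))                ≤⟨ +-mono-≤ 2a≤b+3 (+-mono-≤ (m+n≤o⇒m≤o s s+t≤2) s+t≤2) ⟩
  b + 3 + (2 + 2)                      ≡⟨ solve (b ∷ []) ⟩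
  b + 7                                ∎))
  where open ≤-Reasoning

bound-inherited-by-other : ∀ {a a′ b b′ t} →
  a′ < a → b ≤ b′ + t → t ≤ 2 → 3 ≤ a → 2 * a ≤ b + 3 →
  1 ≤ b′ × 2 * a′ ≤ b′ + 3
bound-inherited-by-other {a} {a′} {b} {b′} {t} a′<a b≤ t≤2 3≤a 2a≤b+3 =
  +-cancelʳ-≤ 5 1 b′ (begin
    6          ≤⟨ *-monoʳ-≤ 2 3≤a ⟩
    2 * a      ≤⟨ 2a≤b+3 ⟩
    b + 3      ≤⟨ b+3≤b′+5 ⟩
    b′ + 5     ∎) ,
  +-cancelʳ-≤ 2 (2 * a′) (b′ + 3) (begin
    2 * a′ + 2  ≡⟨ solve (a′ ∷ []) ⟩
    2 * suc a′  ≤⟨ *-monoʳ-≤ 2 a′<a ⟩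
    2 * a       ≤⟨ 2a≤b+3 ⟩
    b + 3       ≤⟨ b+3≤b′+5 ⟩
    b′ + 5      ≡⟨ solve (b′ ∷ []) ⟩
    b′ + 3 + 2  ∎)
  where
  open ≤-Reasoning
  b+3≤b′+5 : b + 3 ≤ b′ + 5
  b+3≤b′+5 = begin
    b + 3        ≤⟨ +-monoˡ-≤ 3 b≤ ⟩
    b′ + t + 3   ≤⟨ +-monoˡ-≤ 3 (+-monoʳ-≤ b′ t≤2) ⟩
    b′ + 2 + 3   ≡⟨ solve (b′ ∷ []) ⟩
    b′ + 5       ∎

searchFin : {P : Pred (Fin n) ℓ} {Q : Pred (Fin n) ℓ′} → (∀ i → P i ⊎ Q i) → (∀ i → P i) ⊎ ∃ Q
searchFin {n = 0} _ = inj₁ λ ()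
searchFin {n = suc n} d with d zero | searchFin (d ∘ suc)
... | inj₂ q₀ | _ = inj₂ (zero , q₀)
... | inj₁ _ | inj₂ (i , qᵢ) = inj₂ (suc i , qᵢ)
... | inj₁ p₀ | inj₁ ps = inj₁ λ { zero → p₀ ; (suc i) → ps i }

_≟ⱽ_ : ∀ {p q} → DecidableEquality (V p q)
_≟ⱽ_ = ≡-dec _≟_ _≟_

_∈ˡ?_ : ∀ {p q} (v : V p q) (S : List (V p q)) → Dec (v ∈ˡ S)
v ∈ˡ? S = DecMembership._∈?_ _≟ⱽ_ v S

module _ {p q : ℕ} where

  private
    variable
      P : Pred (V p q) ℓ
      Q : Pred (V p q) ℓ′

  searchⱽ : (∀ v → P v ⊎ Q v) → (∀ v → P v) ⊎ ∃ Q
  searchⱽ d with searchFin (d ∘ inj₁) | searchFin (d ∘ inj₂)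
  ... | inj₂ (x , qx) | _ = inj₂ (inj₁ x , qx)
  ... | inj₁ _ | inj₂ (y , qy) = inj₂ (inj₂ y , qy)
  ... | inj₁ px | inj₁ py = inj₁ λ { (inj₁ x) → px x ; (inj₂ y) → py y }

  any?ⱽ : Decidable P → Dec (∃ P)
  any?ⱽ P? = [ (λ ¬P → no λ (v , pv) → ¬P v pv) , yes ]′ (searchⱽ (swap ∘ toSum ∘ P?))

  search≤2 : {P : Pred (List (V p q)) ℓ} {Q : Pred (List (V p q)) ℓ′} → (∀ S → P S ⊎ Q S) →
    (∀ S → length S ≤ 2 → P S) ⊎ ∃ λ S → length S ≤ 2 × Q S
  search≤2 d with d [] | searchⱽ (d ∘ [_]) | searchⱽ (λ a → searchⱽ (λ b → d (a ∷ b ∷ [])))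
  ... | inj₂ q₀ | _ | _ = inj₂ ([] , z≤n , q₀)
  ... | inj₁ _ | inj₂ (a , q₁) | _ = inj₂ (a ∷ [] , s≤s z≤n , q₁)
  ... | inj₁ _ | inj₁ _ | inj₂ (a , b , q₂) = inj₂ (a ∷ b ∷ [] , s≤s (s≤s z≤n) , q₂)
  ... | inj₁ p₀ | inj₁ p₁ | inj₁ p₂ = inj₁ λ where
    [] _ → p₀
    (a ∷ []) _ → p₁ a
    (a ∷ b ∷ []) _ → p₂ a b
    (_ ∷ _ ∷ _ ∷ _) (s≤s (s≤s ()))

  _∖?_ : {W : VSet p q} → Decidable W → (S : List (V p q)) → Decidable (W ∖ S)
  (W? ∖? S) v = W? v ×-dec ¬? (v ∈ˡ? S)

  onX : List (V p q) → Subset p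
  onX [] = ⊥
  onX (inj₁ x ∷ S) = ⁅ x ⁆ ∪ onX S
  onX (inj₂ _ ∷ S) = onX S

  onY : List (V p q) → Subset q
  onY [] = ⊥
  onY (inj₁ _ ∷ S) = onY S
  onY (inj₂ y ∷ S) = ⁅ y ⁆ ∪ onY S

  ∈-onX : ∀ {x S} → inj₁ x ∈ˡ S → x ∈ onX S
  ∈-onX {S = inj₁ x ∷ _} (here refl) = x∈p∪q⁺ (inj₁ (x∈⁅x⁆ x))
  ∈-onX {S = inj₁ _ ∷ _} (there x∈S) = x∈p∪q⁺ (inj₂ (∈-onX x∈S))
  ∈-onX {S = inj₂ _ ∷ _} (there x∈S) = ∈-onX x∈S

  ∈-onY : ∀ {y S} → inj₂ y ∈ˡ S → y ∈ onY S
  ∈-onY {S = inj₂ y ∷ _} (here refl) = x∈p∪q⁺ (inj₁ (x∈⁅x⁆ y))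
  ∈-onY {S = inj₂ _ ∷ _} (there y∈S) = x∈p∪q⁺ (inj₂ (∈-onY y∈S))
  ∈-onY {S = inj₁ _ ∷ _} (there y∈S) = ∈-onY y∈S

  ∣onX∣+∣onY∣≤length : ∀ S → ∣ onX S ∣ + ∣ onY S ∣ ≤ length S
  ∣onX∣+∣onY∣≤length [] = ≤-reflexive (cong₂ _+_ (∣⊥∣≡0 p) (∣⊥∣≡0 q))
  ∣onX∣+∣onY∣≤length (inj₁ x ∷ S) = begin
    ∣ ⁅ x ⁆ ∪ onX S ∣ + ∣ onY S ∣      ≤⟨ +-monoˡ-≤ _ (∣p∪q∣≤∣p∣+∣q∣ ⁅ x ⁆ (onX S)) ⟩
    ∣ ⁅ x ⁆ ∣ + ∣ onX S ∣ + ∣ onY S ∣  ≡⟨ cong (λ k → k + ∣ onX S ∣ + ∣ onY S ∣) (∣⁅x⁆∣≡1 x) ⟩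
    suc (∣ onX S ∣ + ∣ onY S ∣)        ≤⟨ s≤s (∣onX∣+∣onY∣≤length S) ⟩
    suc (length S)                      ∎
    where open ≤-Reasoning
  ∣onX∣+∣onY∣≤length (inj₂ y ∷ S) = begin
    ∣ onX S ∣ + ∣ ⁅ y ⁆ ∪ onY S ∣      ≤⟨ +-monoʳ-≤ _ (∣p∪q∣≤∣p∣+∣q∣ ⁅ y ⁆ (onY S)) ⟩
    ∣ onX S ∣ + (∣ ⁅ y ⁆ ∣ + ∣ onY S ∣) ≡⟨ cong (λ k → ∣ onX S ∣ + (k + ∣ onY S ∣)) (∣⁅x⁆∣≡1 y) ⟩
    ∣ onX S ∣ + suc ∣ onY S ∣          ≡⟨ +-suc _ _ ⟩
    suc (∣ onX S ∣ + ∣ onY S ∣)        ≤⟨ s≤s (∣onX∣+∣onY∣≤length S) ⟩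
    suc (length S)                      ∎
    where open ≤-Reasoning

module _ {p q : ℕ} (E : BipGraph p q) where

  private
    variable
      W W′ : VSet p q
      a b c u v : V p q

  Adj-sym : Adj E a b → Adj E b a
  Adj-sym {inj₁ _} {inj₂ _} ab = ab
  Adj-sym {inj₂ _} {inj₁ _} ab = ab

  Adj? : ∀ a b → Dec (Adj E a b)
  Adj? (inj₁ x) (inj₂ y) = E x y Bool.≟ true
  Adj? (inj₂ y) (inj₁ x) = E x y Bool.≟ true
  Adj? (inj₁ _) (inj₁ _) = no λ ()
  Adj? (inj₂ _) (inj₂ _) = no λ ()

  Reach-source : Reach E W a b → W a
  Reach-source (here Wa) = Wa
  Reach-source (step Wa _ _) = Wa

  Reach-mono : (∀ {v} → W v → W′ v) → Reach E W a b → Reach E W′ a b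
  Reach-mono W⊆W′ (here Wa) = here (W⊆W′ Wa)
  Reach-mono W⊆W′ (step Wa ab r) = step (W⊆W′ Wa) ab (Reach-mono W⊆W′ r)

  Reach-snoc : Reach E W a b → Adj E b c → W c → Reach E W a c
  Reach-snoc (here Wa) ab Wb = step Wa ab (here Wb)
  Reach-snoc (step Wa ab r) bc Wc = step Wa ab (Reach-snoc r bc Wc)

  Reach-avoiding : v ≢ u → Reach E W a v →
    Reach E (W ∖ [ u ]) a v ⊎ ∃ λ w → Adj E u w × Reach E (W ∖ [ u ]) w v
  Reach-avoiding v≢u (here Wv) = inj₁ (here (Wv , λ { (here v≡u) → v≢u v≡u }))
  Reach-avoiding {u = u} v≢u (step {a} {b} Wa ab r) with Reach-avoiding v≢u r
  ... | inj₂ later = inj₂ later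
  ... | inj₁ r′ with a ≟ⱽ u
  ...   | yes refl = inj₂ (b , ab , r′)
  ...   | no a≢u = inj₁ (step (Wa , λ { (here a≡u) → a≢u a≡u }) ab r′)

  ∉-∖-self : (W : VSet p q) → ¬ (W ∖ [ u ]) u
  ∉-∖-self _ (_ , u∉) = u∉ (here refl)

  Reach-first-step : u ≢ v → Reach E W u v → ∃ λ w → Adj E u w × Reach E (W ∖ [ u ]) w v
  Reach-first-step {W = W} u≢v r with Reach-avoiding (u≢v ∘ sym) r
  ... | inj₁ r′ = ⊥-elim (∉-∖-self W (Reach-source r′))
  ... | inj₂ first = first

  size : Decidable W → ℕ
  size W? = ∣ subset (W? ∘ inj₁) ∣ + ∣ subset (W? ∘ inj₂) ∣

  size-∖-< : (W? : Decidable W) → W u → size (W? ∖? [ u ]) < size W?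
  size-∖-< {W = W} {u = inj₁ x} W? Wu =
    +-mono-<-≤ (∣subset∣-mono-< ((W? ∖? [ inj₁ x ]) ∘ inj₁) (W? ∘ inj₁) proj₁ Wu (∉-∖-self W))
               (∣subset∣-mono-≤ ((W? ∖? [ inj₁ x ]) ∘ inj₂) (W? ∘ inj₂) proj₁)
  size-∖-< {W = W} {u = inj₂ y} W? Wu =
    +-mono-≤-< (∣subset∣-mono-≤ ((W? ∖? [ inj₂ y ]) ∘ inj₁) (W? ∘ inj₁) proj₁)
               (∣subset∣-mono-< ((W? ∖? [ inj₂ y ]) ∘ inj₂) (W? ∘ inj₂) proj₁ Wu (∉-∖-self W))

  reach? : Decidable W → ∀ u v → Dec (Reach E W u v)
  reach? W? = go W? (<-wellFounded _)
    where
    go : ∀ {W} (W? : Decidable W) → Acc _<_ (size W?) → ∀ u v → Dec (Reach E W u v)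
    go W? (acc smaller) u v with W? u | u ≟ⱽ v
    ... | no ¬Wu | _ = no (¬Wu ∘ Reach-source)
    ... | yes Wu | yes refl = yes (here Wu)
    ... | yes Wu | no u≢v =
      map′ (λ (w , uw , r) → step Wu uw (Reach-mono proj₁ r)) (Reach-first-step u≢v)
        (any?ⱽ λ w → Adj? u w ×-dec go (W? ∖? [ u ]) (smaller (size-∖-< W? Wu)) w v)

  reach?-constant-on-edges : (W? : Decidable W) (u : V p q) {a b : V p q} →
    W a → W b → Adj E a b → does (reach? W? u a) ≡ does (reach? W? u b)
  reach?-constant-on-edges W? u {a} {b} Wa Wb ab with reach? W? u a | reach? W? u b
  ... | yes _ | yes _ = refl
  ... | no _ | no _ = refl
  ... | yes u⇝a | no ¬u⇝b = ⊥-elim (¬u⇝b (Reach-snoc u⇝a ab Wb))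
  ... | no ¬u⇝a | yes u⇝b = ⊥-elim (¬u⇝a (Reach-snoc u⇝b (Adj-sym ab) Wa))

  Disconnected : VSet p q → Set
  Disconnected W = ∃ λ u → ∃ λ v → W u × W v × ¬ Reach E W u v

  connected⊎disconnected : Decidable W → Connected E W ⊎ Disconnected W
  connected⊎disconnected {W} W? = searchⱽ λ u → searchⱽ λ v → reach⊎separated u v
    where
    reach⊎separated : ∀ u v → (W u → W v → Reach E W u v) ⊎ (W u × W v × ¬ Reach E W u v)
    reach⊎separated u v with reach? W? u v | W? u ×-dec W? v
    ... | yes u⇝v | _ = inj₁ λ _ _ → u⇝v
    ... | no ¬u⇝v | yes (Wu , Wv) = inj₂ (Wu , Wv , ¬u⇝v)
    ... | no _ | no ¬WuWv = inj₁ λ Wu Wv → ⊥-elim (¬WuWv (Wu , Wv))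

  noSmallCut⊎separation : Decidable W →
    (∀ S → length S ≤ 2 → Connected E (W ∖ S)) ⊎ ∃ λ S → length S ≤ 2 × Disconnected (W ∖ S)
  noSmallCut⊎separation W? = search≤2 λ S → connected⊎disconnected (W? ∖? S)

module _ {p q : ℕ} (E : BipGraph p q) where

  NZ? : (Z : Subset q) → Decidable (NZ E Z)
  NZ? Z (inj₁ x) = any? λ z → z ∈? Z ×-dec E x z Bool.≟ true
  NZ? Z (inj₂ y) = y ∈? Z

  N : Subset q → Subset p
  N Z = subset (NZ? Z ∘ inj₁)

  Admissible : Subset q → Set
  Admissible Z = Nonempty Z × 2 * ∣ N Z ∣ ≤ ∣ Z ∣ + 3

  weight : Subset q → ℕ
  weight Z = ∣ N Z ∣ + ∣ Z ∣

  LighterAdmissible : Subset q → Set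
  LighterAdmissible Z = ∃ λ Z′ → Admissible Z′ × weight Z′ < weight Z

  module Split (Z : Subset q) (S : List (V p q)) (c : V p q → Bool)
    (c-constant-on-edges : ∀ {a b} → (NZ E Z ∖ S) a → (NZ E Z ∖ S) b → Adj E a b → c a ≡ c b)
    where

    W : VSet p q
    W = NZ E Z ∖ S

    W? : Decidable W
    W? = NZ? Z ∖? S

    Z∩? : ∀ β → Decidable λ y → W (inj₂ y) × c (inj₂ y) ≡ β
    Z∩? β y = W? (inj₂ y) ×-dec c (inj₂ y) Bool.≟ β

    X∩? : ∀ β → Decidable λ x → NZ E Z (inj₁ x) × (inj₁ x ∈ˡ S ⊎ c (inj₁ x) ≡ β)
    X∩? β x = NZ? Z (inj₁ x) ×-dec (inj₁ x ∈ˡ? S ⊎-dec c (inj₁ x) Bool.≟ β)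

    Z∩ : Bool → Subset q
    Z∩ β = subset (Z∩? β)

    X∩ : Bool → Subset p
    X∩ β = subset (X∩? β)

    N[Z∩]⊆X∩ : ∀ β → N (Z∩ β) ⊆ X∩ β
    N[Z∩]⊆X∩ β {x} x∈ with ∈-subset⁻ (NZ? (Z∩ β) ∘ inj₁) x∈
    ... | z , z∈ , xz with ∈-subset⁻ (Z∩? β) z∈
    ...   | Wz , cz≡β = ∈-subset⁺ (X∩? β) (x∈N[Z] , in-S-or-β)
      where
      x∈N[Z] : NZ E Z (inj₁ x)
      x∈N[Z] = z , proj₁ Wz , xz
      in-S-or-β : inj₁ x ∈ˡ S ⊎ c (inj₁ x) ≡ β
      in-S-or-β with inj₁ x ∈ˡ? S
      ... | yes x∈S = inj₁ x∈S
      ... | no x∉S = inj₂ (trans (c-constant-on-edges (x∈N[Z] , x∉S) Wz xz) cz≡β)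

    Z∩⊆Z : ∀ β → Z∩ β ⊆ Z
    Z∩⊆Z β y∈ = proj₁ (proj₁ (∈-subset⁻ (Z∩? β) y∈))

    X∩⊆N : ∀ β → X∩ β ⊆ N Z
    X∩⊆N β = subset-⊆ (X∩? β) (NZ? Z ∘ inj₁) proj₁

    ∣X∩∣≤∣N∣ : ∀ β → ∣ X∩ β ∣ ≤ ∣ N Z ∣
    ∣X∩∣≤∣N∣ β = p⊆q⇒∣p∣≤∣q∣ (X∩⊆N β)

    ∣X∩∣<∣N∣ : ∀ β {x} → W (inj₁ x) → c (inj₁ x) ≢ β → ∣ X∩ β ∣ < ∣ N Z ∣
    ∣X∩∣<∣N∣ β (x∈N[Z] , x∉S) cx≢β =
      ∣subset∣-mono-< (X∩? β) (NZ? Z ∘ inj₁) proj₁ x∈N[Z]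
        λ (_ , in-S-or-β) → [ x∉S , cx≢β ]′ in-S-or-β

    ∣Z∩∣<∣Z∣ : ∀ β {y} → W (inj₂ y) → c (inj₂ y) ≢ β → ∣ Z∩ β ∣ < ∣ Z ∣
    ∣Z∩∣<∣Z∣ β {y} (y∈Z , _) cy≢β =
      p⊂q⇒∣p∣<∣q∣ (Z∩⊆Z β , y , y∈Z , λ y∈ → cy≢β (proj₂ (∈-subset⁻ (Z∩? β) y∈)))

    weight-< : ∀ β {w} → W w → c w ≢ β → weight (Z∩ β) < weight Z
    weight-< β {w} Ww cw≢β = begin-strict
      ∣ N (Z∩ β) ∣ + ∣ Z∩ β ∣ ≤⟨ +-monoˡ-≤ _ (p⊆q⇒∣p∣≤∣q∣ (N[Z∩]⊆X∩ β)) ⟩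
      ∣ X∩ β ∣ + ∣ Z∩ β ∣     <⟨ X∩+Z∩< w Ww cw≢β ⟩
      ∣ N Z ∣ + ∣ Z ∣          ∎
      where
      open ≤-Reasoning
      X∩+Z∩< : ∀ w → W w → c w ≢ β → ∣ X∩ β ∣ + ∣ Z∩ β ∣ < ∣ N Z ∣ + ∣ Z ∣
      X∩+Z∩< (inj₁ x) Wx cx≢β = +-mono-<-≤ (∣X∩∣<∣N∣ β Wx cx≢β) (p⊆q⇒∣p∣≤∣q∣ (Z∩⊆Z β))
      X∩+Z∩< (inj₂ y) Wy cy≢β = +-mono-≤-< (∣X∩∣≤∣N∣ β) (∣Z∩∣<∣Z∣ β Wy cy≢β)

    ∣X∩∣+∣X∩not∣≤∣N∣+∣onX∣ : ∀ β → ∣ X∩ β ∣ + ∣ X∩ (not β) ∣ ≤ ∣ N Z ∣ + ∣ onX S ∣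
    ∣X∩∣+∣X∩not∣≤∣N∣+∣onX∣ β = begin
      ∣ X∩ β ∣ + ∣ X∩ (not β) ∣
        ≡⟨ sym (∣p∪q∣+∣p∩q∣≡∣p∣+∣q∣ (X∩ β) (X∩ (not β))) ⟩
      ∣ X∩ β ∪ X∩ (not β) ∣ + ∣ X∩ β ∩ X∩ (not β) ∣
        ≤⟨ +-mono-≤ (p⊆q⇒∣p∣≤∣q∣ ∪⊆N) (p⊆q⇒∣p∣≤∣q∣ ∩⊆onX) ⟩
      ∣ N Z ∣ + ∣ onX S ∣
        ∎
      where
      open ≤-Reasoning
      ∪⊆N : X∩ β ∪ X∩ (not β) ⊆ N Z
      ∪⊆N x∈ = [ X∩⊆N β , X∩⊆N (not β) ]′ (x∈p∪q⁻ (X∩ β) (X∩ (not β)) x∈)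
      ∩⊆onX : X∩ β ∩ X∩ (not β) ⊆ onX S
      ∩⊆onX x∈ with x∈p∩q⁻ (X∩ β) (X∩ (not β)) x∈
      ... | x∈X∩β , x∈X∩notβ
        with proj₂ (∈-subset⁻ (X∩? β) x∈X∩β) | proj₂ (∈-subset⁻ (X∩? (not β)) x∈X∩notβ)
      ...   | inj₁ x∈S | _ = ∈-onX x∈S
      ...   | _ | inj₁ x∈S = ∈-onX x∈S
      ...   | inj₂ cx≡β | inj₂ cx≡notβ = ⊥-elim (not-¬ cx≡β cx≡notβ)

    ∣Z∣≤∣Z∩∣+∣Z∩not∣+∣onY∣ : ∀ β → ∣ Z ∣ ≤ ∣ Z∩ β ∣ + ∣ Z∩ (not β) ∣ + ∣ onY S ∣
    ∣Z∣≤∣Z∩∣+∣Z∩not∣+∣onY∣ β = begin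
      ∣ Z ∣                                     ≤⟨ p⊆q⇒∣p∣≤∣q∣ Z⊆ ⟩
      ∣ Z∩ β ∪ Z∩ (not β) ∪ onY S ∣           ≤⟨ ∣p∪q∣≤∣p∣+∣q∣ (Z∩ β) _ ⟩
      ∣ Z∩ β ∣ + ∣ Z∩ (not β) ∪ onY S ∣       ≤⟨ +-monoʳ-≤ _ (∣p∪q∣≤∣p∣+∣q∣ (Z∩ (not β)) _) ⟩
      ∣ Z∩ β ∣ + (∣ Z∩ (not β) ∣ + ∣ onY S ∣) ≡⟨ sym (+-assoc ∣ Z∩ β ∣ _ _) ⟩
      ∣ Z∩ β ∣ + ∣ Z∩ (not β) ∣ + ∣ onY S ∣   ∎
      where
      open ≤-Reasoning
      Z⊆ : Z ⊆ Z∩ β ∪ Z∩ (not β) ∪ onY S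
      Z⊆ {y} y∈Z with inj₂ y ∈ˡ? S | c (inj₂ y) Bool.≟ β
      ... | yes y∈S | _ = x∈p∪q⁺ (inj₂ (x∈p∪q⁺ (inj₂ (∈-onY y∈S))))
      ... | no y∉S | yes cy≡β = x∈p∪q⁺ (inj₁ (∈-subset⁺ (Z∩? β) ((y∈Z , y∉S) , cy≡β)))
      ... | no y∉S | no cy≢β =
        x∈p∪q⁺ (inj₂ (x∈p∪q⁺ (inj₁ (∈-subset⁺ (Z∩? (not β)) ((y∈Z , y∉S) , ¬-not cy≢β)))))

    ∣Z∣≤∣Z∩not∣+∣onY∣ : ∀ β → Empty (Z∩ β) → ∣ Z ∣ ≤ ∣ Z∩ (not β) ∣ + ∣ onY S ∣
    ∣Z∣≤∣Z∩not∣+∣onY∣ β empty =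
      subst (λ k → ∣ Z ∣ ≤ k + ∣ Z∩ (not β) ∣ + ∣ onY S ∣) (Empty⇒∣p∣≡0 empty)
        (∣Z∣≤∣Z∩∣+∣Z∩not∣+∣onY∣ β)

    ∣X∩not∣<∣N∣ : ∀ β {w} → Empty (Z∩ β) → W w → c w ≡ β → ∣ X∩ (not β) ∣ < ∣ N Z ∣
    ∣X∩not∣<∣N∣ β {inj₁ x} _ Wx cx≡β = ∣X∩∣<∣N∣ (not β) Wx (not-¬ cx≡β)
    ∣X∩not∣<∣N∣ β {inj₂ y} empty Wy cy≡β = ⊥-elim (empty (y , ∈-subset⁺ (Z∩? β) (Wy , cy≡β)))

  module _ (deg : ∀ y → 3 ≤ degY E y) where

    neighbours⊆N : ∀ {Z y} → y ∈ Z → tabulate (λ x → E x y) ⊆ N Z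
    neighbours⊆N {Z} {y} y∈Z x∈ = ∈-subset⁺ (NZ? Z ∘ inj₁) (y , y∈Z , ∈-tabulate⁻ x∈)

    3≤∣N∣ : ∀ {Z} → Nonempty Z → 3 ≤ ∣ N Z ∣
    3≤∣N∣ (y , y∈Z) = ≤-trans (deg y) (p⊆q⇒∣p∣≤∣q∣ (neighbours⊆N y∈Z))

    moreThan3 : ∀ {Z} → Nonempty Z → MoreThan3 (NZ E Z)
    moreThan3 {Z} (y , y∈Z) with distinct-members (tabulate (λ x → E x y)) (deg y)
    ... | f , f-injective , f∈ =
      inj₂ y , inj₁ (f zero) , inj₁ (f one) , inj₁ (f two) ,
      y∈Z , x∈N zero , x∈N one , x∈N two ,
      (λ ()) , (λ ()) , (λ ()) , f≢ (λ ()) , f≢ (λ ()) , f≢ (λ ())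
      where
      one two : Fin 3
      one = suc zero
      two = suc (suc zero)
      x∈N : ∀ i → NZ E Z (inj₁ (f i))
      x∈N i = y , y∈Z , ∈-tabulate⁻ (f∈ i)
      f≢ : ∀ {i j} → i ≢ j → inj₁ {B = Fin q} (f i) ≢ inj₁ (f j)
      f≢ i≢j = i≢j ∘ f-injective ∘ inj₁-injective

    shrink : ∀ {Z} → Admissible Z → ∀ S → length S ≤ 2 → Disconnected E (NZ E Z ∖ S) →
      LighterAdmissible Z
    shrink {Z} (nonempty , bound) S |S|≤2 (u , v , Wu , Wv , ¬u⇝v) = shrunk
      where
      W? : Decidable (NZ E Z ∖ S)
      W? = NZ? Z ∖? S

      c : V p q → Bool
      c w = does (reach? E W? u w)

      open Split Z S c (reach?-constant-on-edges E W? u) hiding (W?)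

      coloured : ∀ β → ∃ λ w → W w × c w ≡ β
      coloured true = u , Wu , dec-true (reach? E W? u u) (here Wu)
      coloured false = v , Wv , dec-false (reach? E W? u v) ¬u⇝v

      ∣S∣≤2 : ∣ onX S ∣ + ∣ onY S ∣ ≤ 2
      ∣S∣≤2 = ≤-trans (∣onX∣+∣onY∣≤length S) |S|≤2

      candidate : ∀ β → Nonempty (Z∩ β) → 2 * ∣ X∩ β ∣ ≤ ∣ Z∩ β ∣ + 3 → LighterAdmissible Z
      candidate β nonemptyβ boundβ =
        let w , Ww , cw≡notβ = coloured (not β)
        in Z∩ β , (nonemptyβ , ≤-trans (*-monoʳ-≤ 2 (p⊆q⇒∣p∣≤∣q∣ (N[Z∩]⊆X∩ β))) boundβ) ,
           weight-< β Ww λ cw≡β → not-¬ cw≡β cw≡notβ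

      lone : ∀ β → Empty (Z∩ β) → LighterAdmissible Z
      lone β empty =
        let w , Ww , cw≡β = coloured β
            1≤∣Z∩not∣ , bound′ =
              bound-inherited-by-other (∣X∩not∣<∣N∣ β empty Ww cw≡β) (∣Z∣≤∣Z∩not∣+∣onY∣ β empty)
                (m+n≤o⇒n≤o ∣ onX S ∣ ∣S∣≤2) (3≤∣N∣ nonempty) bound
        in candidate (not β) (1≤∣p∣⇒Nonempty 1≤∣Z∩not∣) bound′

      shrunk : LighterAdmissible Z
      shrunk with nonempty? (Z∩ true) | nonempty? (Z∩ false)
      ... | no empty | _ = lone true empty
      ... | _ | no empty = lone false empty
      ... | yes nonempty₁ | yes nonempty₂ =
        [ candidate true nonempty₁ , candidate false nonempty₂ ]′
          (bound-inherited {a₁ = ∣ X∩ true ∣} {a₂ = ∣ X∩ false ∣}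
            (∣X∩∣+∣X∩not∣≤∣N∣+∣onX∣ true) (∣Z∣≤∣Z∩∣+∣Z∩not∣+∣onY∣ true) ∣S∣≤2 bound)

    descend : ∀ Z → Acc _<_ (weight Z) → Admissible Z →
      Σ (Subset q) (λ Z′ → ThreeConnected E (NZ E Z′))
    descend Z (acc lighter) admissible with noSmallCut⊎separation E (NZ? Z)
    ... | inj₁ noSmallCut = Z , moreThan3 (proj₁ admissible) , noSmallCut
    ... | inj₂ (S , |S|≤2 , disconnected) =
      let Z′ , admissible′ , Z′<Z = shrink admissible S |S|≤2 disconnected
      in descend Z′ (lighter Z′<Z) admissible′

  ⊤-admissible : 3 ≤ p → 2 * p ≤ q + 3 → Admissible ⊤
  ⊤-admissible 3≤p 2p≤q+3 =
    1≤∣p∣⇒Nonempty (subst (1 ≤_) (sym (∣⊤∣≡n q)) 1≤q) ,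
    ≤-trans (*-monoʳ-≤ 2 (∣p∣≤n (N ⊤))) (subst (λ k → 2 * p ≤ k + 3) (sym (∣⊤∣≡n q)) 2p≤q+3)
    where
    1≤q : 1 ≤ q
    1≤q = +-cancelʳ-≤ 3 1 q (≤-trans (*-monoʳ-≤ 2 (≤-trans (s≤s (s≤s z≤n)) 3≤p)) 2p≤q+3)

lemma3p3 : ∀ {p q} (E : BipGraph p q) →
    (∀ (y : Fin q) → 3 ≤ degY E y) →
    3 ≤ p → 2 * p ≤ q + 3 →
    Σ (Subset q) (λ Z → ThreeConnected E (NZ E Z))
lemma3p3 E deg 3≤p 2p≤q+3 = descend E deg ⊤ (<-wellFounded _) (⊤-admissible E 3≤p 2p≤q+3)
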